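{- If $H$ is a bipartite graph with $n$ vertices and maximum degree $\Delta\ge 1$, then $r(H)\le \Delta 2^{\Delta+3}n$. In particular, for every positive integer $d$, the Ramsey number of the $d$-cube satisfies $r(Q_d)\le d2^{2d+3}$.
   Context: For a graph $H$, the Ramsey number $r(H)$ is the minimum positive integer $N$ such that every $2$-coloring of the edges of $K_N$ contains a monochromatic copy of $H$. The $d$-cube $Q_d$ is the graph on $\{0,1\}^d$ in which two vectors are adjacent iff they differ in exactly one coordinate. -}

module Defs where

open import Data.Nat using (ℕ; zero; suc; _+_; _≤_)
open import Data.Bool using (Bool; true; false; if_then_else_; _xor_)
open import Data.Fin using (Fin)
open import Data.List using (map; allFin)
open import Data.Nat.ListAction using (sum)
open import Data.Vec using (Vec; []; _∷_)
open import Data.Product using (Σ; _×_; ∃; _,_)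
open import Relation.Binary.PropositionalEquality using (_≡_; refl; cong; cong₂)
open import Relation.Nullary using (¬_)
open import Function.Definitions using (Injective)

record SimpleGraph (V : Set) : Set where
  field
    Adj   : V → V → Bool
    sym   : ∀ u v → Adj u v ≡ Adj v u
    irrefl : ∀ v → Adj v v ≡ false
open SimpleGraph public

degree : ∀ {n} → SimpleGraph (Fin n) → Fin n → ℕ
degree {n} G i = sum (map (λ j → if Adj G i j then 1 else 0) (allFin n))

MaxDegree : ∀ {n} → SimpleGraph (Fin n) → ℕ → Set
MaxDegree {n} G Δ = (∀ i → degree G i ≤ Δ) × (∃ λ i → degree G i ≡ Δ)

Bipartite : ∀ {V} → SimpleGraph V → Set
Bipartite {V} G = Σ (V → Bool) λ side → ∀ u v → Adj G u v ≡ true → ¬ (side u ≡ side v)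

-- Every 2-colouring of the edges of K_N (a symmetric colour function on pairs)
-- contains a monochromatic (not necessarily induced) copy of G.
Arrows : ∀ {V} → ℕ → SimpleGraph V → Set
Arrows {V} N G =
  (c : Fin N → Fin N → Bool) → (∀ i j → c i j ≡ c j i) →
  Σ Bool λ b → Σ (V → Fin N) λ f →
    Injective _≡_ _≡_ f × (∀ u v → Adj G u v ≡ true → c (f u) (f v) ≡ b)

-- r(G) ≤ M : the least N with K_N → G is at most M, i.e. some N ≤ M has the property.
RamseyAtMost : ∀ {V} → SimpleGraph V → ℕ → Set
RamseyAtMost G M = ∃ λ N → N ≤ M × Arrows N G

hamming : ∀ {d} → Vec Bool d → Vec Bool d → ℕ
hamming [] [] = 0
hamming (a ∷ x) (b ∷ y) = (if a xor b then 1 else 0) + hamming x y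

private
  xor-comm : ∀ a b → (a xor b) ≡ (b xor a)
  xor-comm false false = refl
  xor-comm false true = refl
  xor-comm true false = refl
  xor-comm true true = refl

  xor-self : ∀ a → (a xor a) ≡ false
  xor-self false = refl
  xor-self true = refl

  hamming-sym : ∀ {d} (x y : Vec Bool d) → hamming x y ≡ hamming y x
  hamming-sym [] [] = refl
  hamming-sym (a ∷ x) (b ∷ y) =
    cong₂ _+_ (cong (λ t → if t then 1 else 0) (xor-comm a b)) (hamming-sym x y)

  hamming-self : ∀ {d} (x : Vec Bool d) → hamming x x ≡ 0
  hamming-self [] = refl
  hamming-self (a ∷ x) rewrite xor-self a = hamming-self x

  isOne : ℕ → Bool
  isOne (suc zero) = true
  isOne _ = false

Q : (d : ℕ) → SimpleGraph (Vec Bool d)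
Q d = record
  { Adj = λ x y → isOne (hamming x y)
  ; sym = λ x y → cong isOne (hamming-sym x y)
  ; irrefl = λ x → cong isOne (hamming-self x)
  }

module Submission where

-- Dependent random choice, done
-- deterministically by double counting: averaging over colours b and Δ-tuples
-- T (using the power-mean inequality for the degrees) yields b and T whose
-- common b-neighbourhood U has more than 4Δn vertices while T is not "Δ-bad",
-- a recursive notion saying that few extensions of T by vertices of U lose
-- their large common neighbourhood.  A greedy embedding then maps one side of
-- H into U vertex by vertex, keeping for each vertex of the other side the
-- tuple of images of its neighbours not bad; finally each vertex of the other
-- side is mapped into the (large) common neighbourhood of that tuple.

module Counting where

  open import Data.Nat
  open import Data.Nat.Properties
  open import Data.Bool using (Bool; true; false; if_then_else_; _∧_; _∨_; not)
  open import Data.Bool.Properties using (∧-zeroʳ)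
  open import Data.Fin using (Fin; zero; suc)
  open import Data.List using (List; []; _∷_; map; tabulate)
  open import Data.Bool.ListAction using (all)
  open import Data.Nat.ListAction using (sum)
  open import Data.Product using (Σ; _×_; _,_)
  open import Relation.Binary.PropositionalEquality
  open import Relation.Nullary using (¬_; yes; no)
  open import Algebra.Properties.CommutativeSemigroup +-commutativeSemigroup using (interchange)

  ⌜_⌝ : Bool → ℕ
  ⌜ b ⌝ = if b then 1 else 0

  ⌜⌝≤1 : ∀ b → ⌜ b ⌝ ≤ 1
  ⌜⌝≤1 true = ≤-refl
  ⌜⌝≤1 false = z≤n

  ⌜⌝-mono : ∀ {a b} → (a ≡ true → b ≡ true) → ⌜ a ⌝ ≤ ⌜ b ⌝
  ⌜⌝-mono {false} _ = z≤n
  ⌜⌝-mono {true} h rewrite h refl = ≤-refl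

  true≢false : ¬ (true ≡ false)
  true≢false ()

  ∧-elimˡ : ∀ {a b} → a ∧ b ≡ true → a ≡ true
  ∧-elimˡ {true} _ = refl

  ∧-elimʳ : ∀ {a b} → a ∧ b ≡ true → b ≡ true
  ∧-elimʳ {true} e = e

  not-true : ∀ {a} → not a ≡ true → a ≡ false
  not-true {false} _ = refl

  σ : (k : ℕ) → (Fin k → ℕ) → ℕ
  σ zero f = 0
  σ (suc k) f = f zero + σ k (λ i → f (suc i))

  σ-cong : ∀ k {f g : Fin k → ℕ} → (∀ i → f i ≡ g i) → σ k f ≡ σ k g
  σ-cong zero e = refl
  σ-cong (suc k) e = cong₂ _+_ (e zero) (σ-cong k (λ i → e (suc i)))

  σ-mono : ∀ k {f g : Fin k → ℕ} → (∀ i → f i ≤ g i) → σ k f ≤ σ k g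
  σ-mono zero e = z≤n
  σ-mono (suc k) e = +-mono-≤ (e zero) (σ-mono k (λ i → e (suc i)))

  σ-+ : ∀ k (f g : Fin k → ℕ) → σ k (λ i → f i + g i) ≡ σ k f + σ k g
  σ-+ zero f g = refl
  σ-+ (suc k) f g rewrite σ-+ k (λ i → f (suc i)) (λ i → g (suc i)) =
    interchange (f zero) (g zero) (σ k (λ i → f (suc i))) (σ k (λ i → g (suc i)))

  σ-*ˡ : ∀ k c (f : Fin k → ℕ) → σ k (λ i → c * f i) ≡ c * σ k f
  σ-*ˡ zero c f = sym (*-zeroʳ c)
  σ-*ˡ (suc k) c f rewrite σ-*ˡ k c (λ i → f (suc i)) = sym (*-distribˡ-+ c (f zero) _)

  σ-const : ∀ k c → σ k (λ _ → c) ≡ k * c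
  σ-const zero c = refl
  σ-const (suc k) c = cong (c +_) (σ-const k c)

  σ-zero : ∀ k (f : Fin k → ℕ) → (∀ i → f i ≡ 0) → σ k f ≡ 0
  σ-zero k f h = trans (σ-cong k h) (trans (σ-const k 0) (*-zeroʳ k))

  σ-swap : ∀ k m (f : Fin k → Fin m → ℕ) →
    σ k (λ i → σ m (λ j → f i j)) ≡ σ m (λ j → σ k (λ i → f i j))
  σ-swap zero m f = sym (σ-zero m _ (λ _ → refl))
  σ-swap (suc k) m f = begin
    σ m (f zero) + σ k (λ i → σ m (f (suc i)))   ≡⟨ cong (σ m (f zero) +_) (σ-swap k m (λ i → f (suc i))) ⟩
    σ m (f zero) + σ m (λ j → σ k (λ i → f (suc i) j)) ≡⟨ sym (σ-+ m _ _) ⟩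
    σ m (λ j → f zero j + σ k (λ i → f (suc i) j)) ∎
    where open ≡-Reasoning

  σ-< : ∀ k (f g : Fin k → ℕ) → σ k f < σ k g → Σ (Fin k) λ i → f i < g i
  σ-< (suc k) f g lt with f zero <? g zero
  ... | yes p = zero , p
  ... | no p with σ-< k (λ i → f (suc i)) (λ i → g (suc i))
                   (+-cancelˡ-< (g zero) _ _ (≤-<-trans (+-monoˡ-≤ _ (≮⇒≥ p)) lt))
  ... | i , q = suc i , q

  cnt : (k : ℕ) → (Fin k → Bool) → ℕ
  cnt k P = σ k (λ i → ⌜ P i ⌝)

  cnt≤ : ∀ k P → cnt k P ≤ k
  cnt≤ k P = ≤-trans (σ-mono k (λ i → ⌜⌝≤1 (P i))) (≤-reflexive (trans (σ-const k 1) (*-identityʳ k)))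

  cnt-mono : ∀ k {P Q : Fin k → Bool} → (∀ i → P i ≡ true → Q i ≡ true) → cnt k P ≤ cnt k Q
  cnt-mono k h = σ-mono k (λ i → ⌜⌝-mono (h i))

  cnt-split : ∀ k (P Q : Fin k → Bool) →
    cnt k P ≡ cnt k (λ i → P i ∧ not (Q i)) + cnt k (λ i → P i ∧ Q i)
  cnt-split k P Q = trans (σ-cong k (λ i → split (P i) (Q i))) (σ-+ k _ _)
    where
    split : ∀ a b → ⌜ a ⌝ ≡ ⌜ a ∧ not b ⌝ + ⌜ a ∧ b ⌝
    split false b = refl
    split true false = refl
    split true true = refl

  cnt-compl : ∀ k (P : Fin k → Bool) → cnt k P + cnt k (λ i → not (P i)) ≡ k
  cnt-compl k P = trans (sym (σ-+ k _ _))
    (trans (σ-cong k (λ i → one (P i))) (trans (σ-const k 1) (*-identityʳ k)))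
    where
    one : ∀ b → ⌜ b ⌝ + ⌜ not b ⌝ ≡ 1
    one true = refl
    one false = refl

  cnt-pos : ∀ k (P : Fin k → Bool) → 0 < cnt k P → Σ (Fin k) λ i → P i ≡ true
  cnt-pos (suc k) P lt with P zero in e
  ... | true = zero , e
  ... | false with cnt-pos k (λ i → P (suc i)) lt
  ... | i , p = suc i , p

  -- If fewer indices satisfy P ∧ Q than P, some index satisfies P but not Q.
  -- Every "choose a good vertex" step of the proof is an instance of this.
  cnt-witness : ∀ k (P Q : Fin k → Bool) → cnt k (λ i → P i ∧ Q i) < cnt k P →
    Σ (Fin k) λ i → (P i ≡ true) × (Q i ≡ false)
  cnt-witness k P Q lt with cnt-pos k (λ i → P i ∧ not (Q i)) positive
    where
    positive : 0 < cnt k (λ i → P i ∧ not (Q i))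
    positive = +-cancelʳ-< _ 0 _ (subst (cnt k (λ i → P i ∧ Q i) <_) (cnt-split k P Q) lt)
  ... | i , p = i , ∧-elimˡ p , not-true (∧-elimʳ p)

  anyF : (m : ℕ) → (Fin m → Bool) → Bool
  anyF zero h = false
  anyF (suc m) h = h zero ∨ anyF m (λ i → h (suc i))

  anyF-false : ∀ m h → anyF m h ≡ false → ∀ i → h i ≡ false
  anyF-false (suc m) h e i with h zero in h0
  anyF-false (suc m) h e zero | false = h0
  anyF-false (suc m) h e (suc i) | false = anyF-false m (λ i → h (suc i)) e i

  cnt-anyF : ∀ k m (P : Fin k → Bool) (Q : Fin m → Fin k → Bool) →
    cnt k (λ x → P x ∧ anyF m (λ w → Q w x)) ≤ σ m (λ w → cnt k (λ x → P x ∧ Q w x))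
  cnt-anyF k m P Q = ≤-trans (σ-mono k (λ x → ∧-anyF (P x) m (λ w → Q w x)))
                             (≤-reflexive (σ-swap k m (λ x w → ⌜ P x ∧ Q w x ⌝)))
    where
    ∨-bound : ∀ a b → ⌜ a ∨ b ⌝ ≤ ⌜ a ⌝ + ⌜ b ⌝
    ∨-bound false b = ≤-refl
    ∨-bound true b = s≤s z≤n
    anyF-bound : ∀ m h → ⌜ anyF m h ⌝ ≤ σ m (λ i → ⌜ h i ⌝)
    anyF-bound zero h = z≤n
    anyF-bound (suc m) h =
      ≤-trans (∨-bound (h zero) _) (+-monoʳ-≤ ⌜ h zero ⌝ (anyF-bound m (λ i → h (suc i))))
    ∧-anyF : ∀ a m h → ⌜ a ∧ anyF m h ⌝ ≤ σ m (λ i → ⌜ a ∧ h i ⌝)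
    ∧-anyF false m h = z≤n
    ∧-anyF true m h = anyF-bound m h

  _==_ : ∀ {k} → Fin k → Fin k → Bool
  zero == zero = true
  zero == suc _ = false
  suc _ == zero = false
  suc x == suc y = x == y

  ==-refl : ∀ {k} (x : Fin k) → (x == x) ≡ true
  ==-refl zero = refl
  ==-refl (suc x) = ==-refl x

  ==-sym : ∀ {k} (x y : Fin k) → (x == y) ≡ (y == x)
  ==-sym zero zero = refl
  ==-sym zero (suc y) = refl
  ==-sym (suc x) zero = refl
  ==-sym (suc x) (suc y) = ==-sym x y

  ==-sound : ∀ {k} (x y : Fin k) → (x == y) ≡ true → x ≡ y
  ==-sound zero zero e = refl
  ==-sound (suc x) (suc y) e = cong suc (==-sound x y e)

  cnt-image : ∀ k m (d : Fin m → Bool) (g : Fin m → Fin k) →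
    cnt k (λ y → anyF m (λ u → d u ∧ (g u == y))) ≤ cnt m d
  cnt-image k m d g = begin
    cnt k (λ y → true ∧ anyF m (λ u → d u ∧ (g u == y)))
      ≤⟨ cnt-anyF k m (λ _ → true) (λ u y → d u ∧ (g u == y)) ⟩
    σ m (λ u → cnt k (λ y → d u ∧ (g u == y)))
      ≤⟨ σ-mono m (λ u → point (d u) (g u)) ⟩
    cnt m d ∎
    where
    open ≤-Reasoning
    single : ∀ k (t : Fin k) → cnt k (t ==_) ≤ 1
    single (suc k) zero = ≤-reflexive (cong suc (σ-zero k _ (λ _ → refl)))
    single (suc k) (suc t) = single k t
    point : ∀ b t → cnt k (λ y → b ∧ (t == y)) ≤ ⌜ b ⌝
    point false t = ≤-reflexive (σ-zero k _ (λ _ → refl))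
    point true t = single k t

  cntL : ∀ {A : Set} → (A → Bool) → List A → ℕ
  cntL P xs = sum (map (λ x → ⌜ P x ⌝) xs)

  cntL-tabulate : ∀ k {A : Set} (P : A → Bool) (f : Fin k → A) →
    cntL P (tabulate f) ≡ σ k (λ i → ⌜ P (f i) ⌝)
  cntL-tabulate zero P f = refl
  cntL-tabulate (suc k) P f = cong (⌜ P (f zero) ⌝ +_) (cntL-tabulate k P (λ i → f (suc i)))

  cntL-mono : ∀ {A : Set} {P Q : A → Bool} → (∀ x → P x ≡ true → Q x ≡ true) →
    ∀ xs → cntL P xs ≤ cntL Q xs
  cntL-mono h [] = z≤n
  cntL-mono h (x ∷ xs) = +-mono-≤ (⌜⌝-mono (h x)) (cntL-mono h xs)

  -- σTuples N k acc f = Σ over x₁ … x_k < N of f (x_k ∷ … ∷ x₁ ∷ acc):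
  -- summation over k-tuples of vertices, kept as lists extending acc.
  σTuples : (N k : ℕ) → List (Fin N) → (List (Fin N) → ℕ) → ℕ
  σTuples N zero acc f = f acc
  σTuples N (suc k) acc f = σ N (λ x → σTuples N k (x ∷ acc) f)

  σTuples-cong : ∀ N k acc {f g : List (Fin N) → ℕ} → (∀ T → f T ≡ g T) →
    σTuples N k acc f ≡ σTuples N k acc g
  σTuples-cong N zero acc e = e acc
  σTuples-cong N (suc k) acc e = σ-cong N (λ x → σTuples-cong N k (x ∷ acc) e)

  σTuples-+ : ∀ N k acc (f g : List (Fin N) → ℕ) →
    σTuples N k acc (λ T → f T + g T) ≡ σTuples N k acc f + σTuples N k acc g
  σTuples-+ N zero acc f g = refl
  σTuples-+ N (suc k) acc f g = trans (σ-cong N (λ x → σTuples-+ N k (x ∷ acc) f g)) (σ-+ N _ _)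

  σTuples-*ˡ : ∀ N k acc c (f : List (Fin N) → ℕ) →
    σTuples N k acc (λ T → c * f T) ≡ c * σTuples N k acc f
  σTuples-*ˡ N zero acc c f = refl
  σTuples-*ˡ N (suc k) acc c f = trans (σ-cong N (λ x → σTuples-*ˡ N k (x ∷ acc) c f)) (σ-*ˡ N c _)

  σTuples-swap : ∀ N k acc m (F : List (Fin N) → Fin m → ℕ) →
    σTuples N k acc (λ T → σ m (F T)) ≡ σ m (λ j → σTuples N k acc (λ T → F T j))
  σTuples-swap N zero acc m F = refl
  σTuples-swap N (suc k) acc m F =
    trans (σ-cong N (λ x → σTuples-swap N k (x ∷ acc) m F)) (σ-swap N m _)

  σTuples-≤ : ∀ N k acc c (f : List (Fin N) → ℕ) → (∀ T → f T ≤ c) → σTuples N k acc f ≤ N ^ k * c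
  σTuples-≤ N zero acc c f h = ≤-trans (h acc) (≤-reflexive (sym (+-identityʳ c)))
  σTuples-≤ N (suc k) acc c f h = begin
    σ N (λ x → σTuples N k (x ∷ acc) f) ≤⟨ σ-mono N (λ x → σTuples-≤ N k (x ∷ acc) c f h) ⟩
    σ N (λ _ → N ^ k * c)               ≡⟨ σ-const N _ ⟩
    N * (N ^ k * c)                     ≡⟨ sym (*-assoc N (N ^ k) c) ⟩
    N * N ^ k * c                       ∎
    where open ≤-Reasoning

  σTuples-< : ∀ N k acc (f g : List (Fin N) → ℕ) → σTuples N k acc f < σTuples N k acc g →
    Σ (List (Fin N)) λ T → f T < g T
  σTuples-< N zero acc f g lt = acc , lt
  σTuples-< N (suc k) acc f g lt with σ-< N _ _ lt
  ... | x , q = σTuples-< N k (x ∷ acc) f g q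

  σTuples-all : ∀ N k acc (P : Fin N → Bool) →
    σTuples N k acc (λ T → ⌜ all P T ⌝) ≡ ⌜ all P acc ⌝ * cnt N P ^ k
  σTuples-all N zero acc P = sym (*-identityʳ _)
  σTuples-all N (suc k) acc P = begin
    σ N (λ x → σTuples N k (x ∷ acc) (λ T → ⌜ all P T ⌝))
      ≡⟨ σ-cong N (λ x → σTuples-all N k (x ∷ acc) P) ⟩
    σ N (λ x → ⌜ P x ∧ all P acc ⌝ * C ^ k)
      ≡⟨ σ-cong N (λ x → reorder (P x)) ⟩
    σ N (λ x → (⌜ all P acc ⌝ * C ^ k) * ⌜ P x ⌝)
      ≡⟨ σ-*ˡ N (⌜ all P acc ⌝ * C ^ k) (λ x → ⌜ P x ⌝) ⟩
    ⌜ all P acc ⌝ * C ^ k * C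
      ≡⟨ *-assoc ⌜ all P acc ⌝ (C ^ k) C ⟩
    ⌜ all P acc ⌝ * (C ^ k * C)
      ≡⟨ cong (⌜ all P acc ⌝ *_) (*-comm (C ^ k) C) ⟩
    ⌜ all P acc ⌝ * (C * C ^ k) ∎
    where
    open ≡-Reasoning
    C = cnt N P
    reorder : ∀ p → ⌜ p ∧ all P acc ⌝ * C ^ k ≡ (⌜ all P acc ⌝ * C ^ k) * ⌜ p ⌝
    reorder false = sym (*-zeroʳ (⌜ all P acc ⌝ * C ^ k))
    reorder true = sym (*-identityʳ _)

  all-true : ∀ {A : Set} (L : List A) → all (λ _ → true) L ≡ true
  all-true [] = refl
  all-true (x ∷ L) = all-true L

  all-cong : ∀ {A : Set} {P Q : A → Bool} → (∀ x → P x ≡ Q x) → ∀ L → all P L ≡ all Q L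
  all-cong e [] = refl
  all-cong e (x ∷ L) = cong₂ _∧_ (e x) (all-cong e L)

  all-∧ : ∀ {A : Set} (P Q : A → Bool) L → all (λ t → P t ∧ Q t) L ≡ all P L ∧ all Q L
  all-∧ P Q [] = refl
  all-∧ P Q (x ∷ L) with P x | Q x
  ... | true | true = all-∧ P Q L
  ... | true | false = sym (∧-zeroʳ (all P L))
  ... | false | _ = refl

  all-swap : ∀ {A B : Set} (R : A → B → Bool) (L : List A) (M : List B) →
    all (λ s → all (R s) M) L ≡ all (λ t → all (λ s → R s t) L) M
  all-swap R [] M = sym (all-true M)
  all-swap R (s ∷ L) M =
    trans (cong (all (R s) M ∧_) (all-swap R L M)) (sym (all-∧ (R s) _ M))

module Inequalities where

  open import Data.Nat
  open import Data.Nat.Properties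
  open import Data.Nat.Solver using (module +-*-Solver)
  open +-*-Solver
  open import Relation.Binary.PropositionalEquality
  open import Data.Sum using (inj₁; inj₂)
  open import Data.Product using (_,_)

  *-^-distrib : ∀ a b k → (a * b) ^ k ≡ a ^ k * b ^ k
  *-^-distrib a b zero = refl
  *-^-distrib a b (suc k) rewrite *-^-distrib a b k =
    solve 4 (λ a b x y → (a :* b) :* (x :* y) := (a :* x) :* (b :* y)) refl a b (a ^ k) (b ^ k)

  rearrangement-≤ : ∀ r s k → r ≤ s → r * s ^ k + s * r ^ k ≤ r * r ^ k + s * s ^ k
  rearrangement-≤ r s k r≤s with m≤n⇒∃[o]m+o≡n r≤s
  ... | d , refl = begin
    r * B + (r + d) * A     ≡⟨ solve 4 (λ r d A B → r :* B :+ (r :+ d) :* A := (r :* A :+ r :* B) :+ d :* A) refl r d A B ⟩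
    (r * A + r * B) + d * A ≤⟨ +-monoʳ-≤ (r * A + r * B) (*-monoʳ-≤ d (^-monoˡ-≤ k (m≤m+n r d))) ⟩
    (r * A + r * B) + d * B ≡⟨ solve 4 (λ r d A B → (r :* A :+ r :* B) :+ d :* B := r :* A :+ (r :+ d) :* B) refl r d A B ⟩
    r * A + (r + d) * B     ∎
    where
    open ≤-Reasoning
    A = r ^ k
    B = (r + d) ^ k

  rearrangement : ∀ r s k → r * s ^ k + s * r ^ k ≤ r * r ^ k + s * s ^ k
  rearrangement r s k with ≤-total r s
  ... | inj₁ r≤s = rearrangement-≤ r s k r≤s
  ... | inj₂ s≤r = begin
    r * s ^ k + s * r ^ k ≡⟨ +-comm (r * s ^ k) _ ⟩
    s * r ^ k + r * s ^ k ≤⟨ rearrangement-≤ s r k s≤r ⟩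
    s * s ^ k + r * r ^ k ≡⟨ +-comm (s * s ^ k) _ ⟩
    r * r ^ k + s * s ^ k ∎
    where open ≤-Reasoning

  -- Power-mean inequality ((r + s)/2)^k ≤ (r^k + s^k)/2, with denominators cleared.
  power-mean : ∀ r s k → 2 * (r + s) ^ k ≤ 2 ^ k * (r ^ k + s ^ k)
  power-mean r s zero = ≤-refl
  power-mean r s (suc k) = begin
    2 * ((r + s) * (r + s) ^ k)
      ≡⟨ solve 2 (λ a b → con 2 :* (a :* b) := a :* (con 2 :* b)) refl (r + s) ((r + s) ^ k) ⟩
    (r + s) * (2 * (r + s) ^ k)
      ≤⟨ *-monoʳ-≤ (r + s) (power-mean r s k) ⟩
    (r + s) * (2 ^ k * (r ^ k + s ^ k))
      ≡⟨ solve 5 (λ r s P A B → (r :+ s) :* (P :* (A :+ B)) := P :* ((r :* B :+ s :* A) :+ (r :* A :+ s :* B))) refl r s (2 ^ k) (r ^ k) (s ^ k) ⟩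
    2 ^ k * ((r * s ^ k + s * r ^ k) + (r * r ^ k + s * s ^ k))
      ≤⟨ *-monoʳ-≤ (2 ^ k) (+-monoˡ-≤ _ (rearrangement r s k)) ⟩
    2 ^ k * ((r * r ^ k + s * s ^ k) + (r * r ^ k + s * s ^ k))
      ≡⟨ solve 3 (λ P X Y → P :* ((X :+ Y) :+ (X :+ Y)) := (con 2 :* P) :* (X :+ Y)) refl (2 ^ k) (r * r ^ k) (s * s ^ k) ⟩
    2 * 2 ^ k * (r * r ^ k + s * s ^ k) ∎
    where open ≤-Reasoning

  -- The numerical heart of the bound N = Δ 2^(Δ+3) n (here Δ = suc e, p = 2^e):
  --   2^Δ (2Δ n^Δ + p n^e · 4Δn) < p n^e · N.
  -- Dividing by Δ n^(e+1) p it reads 4p + 8p² < 16p², true as p ≥ 1.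
  bound-inequality : ∀ e n → 0 < n →
    2 ^ suc e * (2 * suc e * n ^ suc e + 2 ^ e * n ^ e * (4 * suc e * n))
      < 2 ^ e * n ^ e * (suc e * 2 ^ (suc e + 3) * n)
  bound-inequality e n n>0 = begin-strict
    2 ^ suc e * (2 * D * n ^ suc e + p * nᵉ * (4 * D * n))
      ≡⟨ solve 4 (λ p D n ne → (con 2 :* p) :* (con 2 :* D :* (n :* ne) :+ p :* ne :* (con 4 :* D :* n))
                              := (con 4 :* p :+ con 8 :* p :* p) :* (D :* n :* ne)) refl p D n nᵉ ⟩
    (4 * p + 8 * p * p) * K
      <⟨ *-monoˡ-< K {{>-nonZero K>0}} quadratic ⟩
    16 * p * p * K
      ≡⟨ solve 4 (λ p D n ne → con 16 :* p :* p :* (D :* n :* ne) := p :* ne :* (D :* (con 16 :* p) :* n)) refl p D n nᵉ ⟩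
    p * nᵉ * (D * (16 * p) * n)
      ≡⟨ cong (λ t → p * nᵉ * (D * t * n)) (sym 2^[Δ+3]) ⟩
    p * nᵉ * (D * 2 ^ (suc e + 3) * n) ∎
    where
    open ≤-Reasoning
    p = 2 ^ e
    nᵉ = n ^ e
    D = suc e
    K = D * n * nᵉ
    p>0 : 0 < p
    p>0 = m^n>0 2 e
    K>0 : 0 < K
    K>0 = *-mono-< {0} {D * n} (*-mono-< {0} {D} z<s n>0) (m^n>0 n {{>-nonZero n>0}} e)
    2^[Δ+3] : 2 ^ (suc e + 3) ≡ 16 * p
    2^[Δ+3] = trans (cong (2 *_) (^-distribˡ-+-* 2 e 3))
                   (solve 1 (λ p → con 2 :* (p :* con 8) := con 16 :* p) refl p)
    quadratic : 4 * p + 8 * p * p < 16 * p * p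
    quadratic = begin-strict
      4 * p + 8 * p * p     ≤⟨ +-monoˡ-≤ (8 * p * p) (≤-trans (≤-reflexive (sym (*-identityʳ (4 * p)))) (*-monoʳ-≤ (4 * p) p>0)) ⟩
      4 * p * p + 8 * p * p <⟨ +-monoˡ-< (8 * p * p) (*-monoˡ-< p {{>-nonZero p>0}} (*-monoˡ-< p {{>-nonZero p>0}} {4} {8} (s≤s (s≤s (s≤s (s≤s (s≤s z≤n))))))) ⟩
      8 * p * p + 8 * p * p ≡⟨ solve 1 (λ p → con 8 :* p :* p :+ con 8 :* p :* p := con 16 :* p :* p) refl p ⟩
      16 * p * p            ∎

module DependentRandomChoice where

  open import Data.Nat
  open import Data.Nat.Properties
  open import Data.Nat.Solver using (module +-*-Solver)
  open +-*-Solver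
  open import Data.Bool using (Bool; true; false; _∧_; not; T)
  open import Data.Bool.ListAction using (all)
  open import Data.Bool.Properties using (∧-identityʳ; ∧-zeroʳ)
  open import Data.Unit using (tt)
  open import Data.Fin using (Fin)
  open import Data.List using (List; []; _∷_)
  open import Data.Product using (Σ; _×_; _,_)
  open import Data.Empty using (⊥-elim)
  open import Relation.Binary.PropositionalEquality
  open import Relation.Nullary using (yes; no)
  open Counting
  open Inequalities

  ≤ᵇ-true : ∀ m n → (m ≤ᵇ n) ≡ true → m ≤ n
  ≤ᵇ-true m n e = ≤ᵇ⇒≤ m n (subst T (sym e) tt)

  ≤ᵇ-false : ∀ m n → (m ≤ᵇ n) ≡ false → n < m
  ≤ᵇ-false m n e = ≰⇒> (λ le → subst T e (≤⇒≤ᵇ le))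

  module Colouring (N : ℕ) (c : Fin N → Fin N → Bool) (csym : ∀ i j → c i j ≡ c j i) where

    coloured : Bool → Fin N → Fin N → Bool
    coloured true y t = c y t
    coloured false y t = not (c y t)

    coloured-sound : ∀ b {y t} → coloured b y t ≡ true → c y t ≡ b
    coloured-sound true e = e
    coloured-sound false e = not-true e

    coloured-sym : ∀ b y t → coloured b y t ≡ coloured b t y
    coloured-sym true y t = csym y t
    coloured-sym false y t = cong not (csym y t)

    joined : Bool → Fin N → List (Fin N) → Bool
    joined b y L = all (coloured b y) L

    module Bad (b : Bool) (T : List (Fin N)) (n D : ℕ) where
      U : Fin N → Bool
      U y = joined b y T

      X : ℕ
      X = cnt N U

      bad : ℕ → List (Fin N) → Bool
      bad zero L = cnt N (λ y → joined b y L) ≤ᵇ n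
      bad (suc r) L = X ≤ᵇ 2 * D * cnt N (λ x → U x ∧ bad r (x ∷ L))

      -- badExt r L: the number of r-extensions S of L with S ++ L ⊆ U and 0-bad.
      badExt : ℕ → List (Fin N) → ℕ
      badExt zero L = ⌜ all U L ∧ bad zero L ⌝
      badExt (suc r) L = σ N (λ x → badExt r (x ∷ L))

      bad-extensions : ∀ r L → all U L ≡ true → bad r L ≡ true →
        X ^ r ≤ (2 * D) ^ r * badExt r L
      bad-extensions zero L inU isBad rewrite inU | isBad = ≤-refl
      bad-extensions (suc r) L inU isBad = begin
        X * X ^ r                              ≤⟨ *-monoˡ-≤ (X ^ r) (≤ᵇ-true X _ isBad) ⟩
        2 * D * K * X ^ r                      ≡⟨ *-assoc (2 * D) K (X ^ r) ⟩
        2 * D * (K * X ^ r)                    ≤⟨ *-monoʳ-≤ (2 * D) extensions ⟩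
        2 * D * ((2 * D) ^ r * badExt (suc r) L) ≡⟨ sym (*-assoc (2 * D) ((2 * D) ^ r) _) ⟩
        2 * D * (2 * D) ^ r * badExt (suc r) L ∎
        where
        open ≤-Reasoning
        K = cnt N (λ x → U x ∧ bad r (x ∷ L))
        pointwise : ∀ x → X ^ r * ⌜ U x ∧ bad r (x ∷ L) ⌝ ≤ (2 * D) ^ r * badExt r (x ∷ L)
        pointwise x with U x in ux | bad r (x ∷ L) in bx
        ... | true | true = ≤-trans (≤-reflexive (*-identityʳ (X ^ r)))
                                    (bad-extensions r (x ∷ L) (trans (cong (_∧ all U L) ux) inU) bx)
        ... | true | false = ≤-trans (≤-reflexive (*-zeroʳ (X ^ r))) z≤n
        ... | false | _ = ≤-trans (≤-reflexive (*-zeroʳ (X ^ r))) z≤n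
        extensions : K * X ^ r ≤ (2 * D) ^ r * badExt (suc r) L
        extensions = begin
          K * X ^ r                                   ≡⟨ *-comm K (X ^ r) ⟩
          X ^ r * K                                   ≡⟨ sym (σ-*ˡ N (X ^ r) _) ⟩
          σ N (λ x → X ^ r * ⌜ U x ∧ bad r (x ∷ L) ⌝) ≤⟨ σ-mono N pointwise ⟩
          σ N (λ x → (2 * D) ^ r * badExt r (x ∷ L))  ≡⟨ σ-*ˡ N ((2 * D) ^ r) _ ⟩
          (2 * D) ^ r * badExt (suc r) L              ∎

      not-bad-pred : ∀ r L → 1 ≤ r → bad r L ≡ false →
        2 * D * cnt N (λ x → U x ∧ bad (pred r) (x ∷ L)) < X
      not-bad-pred (suc r) L _ = ≤ᵇ-false X _

      -- A tuple that is not r-bad has more than n common b-neighbours: descend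
      -- r times, each time extending by some x ∈ U keeping the tuple good.
      not-bad-large : 0 < D → ∀ r L → bad r L ≡ false → n < cnt N (λ y → joined b y L)
      not-bad-large D>0 zero L good = ≤ᵇ-false _ n good
      not-bad-large D>0 (suc r) L good
        with cnt-witness N U (λ x → bad r (x ∷ L)) fewBad
        where
        K = cnt N (λ x → U x ∧ bad r (x ∷ L))
        fewBad : K < X
        fewBad = ≤-<-trans (m≤n*m K (2 * D) {{>-nonZero (*-monoʳ-< 2 D>0)}}) (not-bad-pred (suc r) L z<s good)
      ... | x , _ , xGood = ≤-trans (not-bad-large D>0 r (x ∷ L) xGood)
                                    (cnt-mono N (λ y → ∧-elimʳ))

    -- Double counting: badExt counts pairs (T, S) with T inside the common
    -- neighbourhood of the 0-bad tuple S, so summing over all D-tuples T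
    -- gives at most N ^ r choices of S times n ^ D choices of T.
    bad-pairs : ∀ b n D r L → σTuples N D [] (λ T → Bad.badExt b T n D r L) ≤ N ^ r * n ^ D
    bad-pairs b n D zero L with cnt N (λ y → joined b y L) ≤ᵇ n in isBad
    ... | false = ≤-trans (σTuples-≤ N D [] 0 _ (λ T → ≤-reflexive (cong ⌜_⌝ (∧-zeroʳ _))))
                          (≤-trans (≤-reflexive (*-zeroʳ (N ^ D))) z≤n)
    ... | true = begin
      σTuples N D [] (λ T → ⌜ all (λ s → joined b s T) L ∧ true ⌝)
        ≡⟨ σTuples-cong N D [] (λ T → cong ⌜_⌝ (trans (∧-identityʳ _) (transpose T))) ⟩
      σTuples N D [] (λ T → ⌜ all (λ t → joined b t L) T ⌝)
        ≡⟨ σTuples-all N D [] (λ t → joined b t L) ⟩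
      1 * cnt N (λ t → joined b t L) ^ D
        ≤⟨ *-monoʳ-≤ 1 (^-monoˡ-≤ D (≤ᵇ-true _ n isBad)) ⟩
      1 * n ^ D ∎
      where
      open ≤-Reasoning
      transpose : ∀ T → all (λ s → joined b s T) L ≡ all (λ t → joined b t L) T
      transpose T = trans (all-swap (coloured b) L T)
                          (all-cong (λ t → all-cong (λ s → coloured-sym b s t) L) T)

    bad-pairs b n D (suc r) L = begin
      σTuples N D [] (λ T → σ N (λ x → Bad.badExt b T n D r (x ∷ L)))
        ≡⟨ σTuples-swap N D [] N (λ T x → Bad.badExt b T n D r (x ∷ L)) ⟩
      σ N (λ x → σTuples N D [] (λ T → Bad.badExt b T n D r (x ∷ L)))
        ≤⟨ σ-mono N (λ x → bad-pairs b n D r (x ∷ L)) ⟩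
      σ N (λ x → N ^ r * n ^ D)
        ≡⟨ σ-const N _ ⟩
      N * (N ^ r * n ^ D)
        ≡⟨ sym (*-assoc N (N ^ r) (n ^ D)) ⟩
      N * N ^ r * n ^ D ∎
      where open ≤-Reasoning

    -- Σ_T X_b(T) = Σ_y deg_b(y) ^ D: both count pairs (T, y) with T ⊆ N_b(y).
    sum-X : ∀ b n D → σTuples N D [] (λ T → Bad.X b T n D) ≡ σ N (λ y → cnt N (coloured b y) ^ D)
    sum-X b n D = trans (σTuples-swap N D [] N (λ T y → ⌜ joined b y T ⌝))
                        (σ-cong N (λ y → trans (σTuples-all N D [] (coloured b y)) (*-identityˡ _)))

    -- Every vertex has red degree plus blue degree N, so by the power-mean
    -- inequality the two colours together give Σ_T X ≥ 2 N · N ^ D / 2 ^ D.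
    sum-X-lower : ∀ n D →
      2 * N * N ^ D ≤ 2 ^ D * (σTuples N D [] (λ T → Bad.X true T n D) + σTuples N D [] (λ T → Bad.X false T n D))
    sum-X-lower n D = begin
      2 * N * N ^ D
        ≡⟨ trans (cong (_* N ^ D) (*-comm 2 N)) (*-assoc N 2 (N ^ D)) ⟩
      N * (2 * N ^ D)
        ≡⟨ sym (σ-const N _) ⟩
      σ N (λ y → 2 * N ^ D)
        ≡⟨ σ-cong N (λ y → cong (λ z → 2 * z ^ D) (sym (cnt-compl N (c y)))) ⟩
      σ N (λ y → 2 * (deg true y + deg false y) ^ D)
        ≤⟨ σ-mono N (λ y → power-mean (deg true y) (deg false y) D) ⟩
      σ N (λ y → 2 ^ D * (deg true y ^ D + deg false y ^ D))
        ≡⟨ σ-*ˡ N (2 ^ D) _ ⟩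
      2 ^ D * σ N (λ y → deg true y ^ D + deg false y ^ D)
        ≡⟨ cong (2 ^ D *_) (trans (σ-+ N _ _) (sym (cong₂ _+_ (sum-X true n D) (sum-X false n D)))) ⟩
      2 ^ D * (σTuples N D [] (λ T → Bad.X true T n D) + σTuples N D [] (λ T → Bad.X false T n D)) ∎
      where
      open ≤-Reasoning
      deg : Bool → Fin N → ℕ
      deg b y = cnt N (coloured b y)
    -- This is the deterministic form of dependent random choice: we compare
    -- the averages over (b, T) of cost = 2Δ·badExt + q·4Δn and gain = q·X,
    -- where q = (2n)^e, and pick (b, T) with cost < gain.
    module Selection (n e : ℕ) (n>0 : 0 < n) (N≡ : N ≡ suc e * 2 ^ (suc e + 3) * n) where
      D q m : ℕ
      D = suc e
      q = 2 ^ e * n ^ e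
      m = 4 * D * n

      open module BadB (b : Bool) (T : List (Fin N)) = Bad b T n D using (X; bad; badExt)

      cost gain : Bool → List (Fin N) → ℕ
      cost b T = 2 * D * badExt b T D [] + q * m
      gain b T = q * X b T

      ΣX : Bool → ℕ
      ΣX b = σTuples N D [] (X b)

      costBound : ℕ
      costBound = 2 * D * (N ^ D * n ^ D) + N ^ D * (q * m)

      sum-cost : ∀ b → σTuples N D [] (cost b) ≤ costBound
      sum-cost b = begin
        σTuples N D [] (cost b)
          ≡⟨ σTuples-+ N D [] _ _ ⟩
        σTuples N D [] (λ T → 2 * D * badExt b T D []) + σTuples N D [] (λ T → q * m)
          ≤⟨ +-mono-≤ (≤-trans (≤-reflexive (σTuples-*ˡ N D [] (2 * D) _)) (*-monoʳ-≤ (2 * D) (bad-pairs b n D D [])))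
                      (σTuples-≤ N D [] (q * m) _ (λ _ → ≤-refl)) ⟩
        costBound ∎
        where open ≤-Reasoning

      N>0 : 0 < N
      N>0 rewrite N≡ = *-mono-< {0} {D * 2 ^ (D + 3)} (*-mono-< {0} {D} z<s (m^n>0 2 (D + 3))) n>0

      scaled-cost<gain : 2 ^ D * (costBound + costBound) < 2 ^ D * (σTuples N D [] (gain true) + σTuples N D [] (gain false))
      scaled-cost<gain = begin-strict
        2 ^ D * (costBound + costBound)
          ≡⟨ solve 6 (λ P R ND nD Q m → P :* ((R :* (ND :* nD) :+ ND :* (Q :* m)) :+ (R :* (ND :* nD) :+ ND :* (Q :* m)))
                                      := (con 2 :* ND) :* (P :* (R :* nD :+ Q :* m))) refl (2 ^ D) (2 * D) (N ^ D) (n ^ D) q m ⟩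
        (2 * N ^ D) * (2 ^ D * (2 * D * n ^ D + q * m))
          <⟨ *-monoʳ-< (2 * N ^ D) {{>-nonZero (*-monoʳ-< 2 (m^n>0 N {{>-nonZero N>0}} D))}}
               (subst (λ z → 2 ^ D * (2 * D * n ^ D + q * m) < q * z) (sym N≡) (bound-inequality e n n>0)) ⟩
        (2 * N ^ D) * (q * N)
          ≡⟨ solve 3 (λ ND Q N → (con 2 :* ND) :* (Q :* N) := Q :* (con 2 :* N :* ND)) refl (N ^ D) q N ⟩
        q * (2 * N * N ^ D)
          ≤⟨ *-monoʳ-≤ q (sum-X-lower n D) ⟩
        q * (2 ^ D * (ΣX true + ΣX false))
          ≡⟨ solve 4 (λ Q P a b → Q :* (P :* (a :+ b)) := P :* (Q :* a :+ Q :* b)) refl q (2 ^ D) (ΣX true) (ΣX false) ⟩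
        2 ^ D * (q * ΣX true + q * ΣX false)
          ≡⟨ cong (2 ^ D *_) (sym (cong₂ _+_ (σTuples-*ˡ N D [] q _) (σTuples-*ˡ N D [] q _))) ⟩
        2 ^ D * (σTuples N D [] (gain true) + σTuples N D [] (gain false)) ∎
        where open ≤-Reasoning

      total-cost<gain : σTuples N D [] (cost true) + σTuples N D [] (cost false)
                      < σTuples N D [] (gain true) + σTuples N D [] (gain false)
      total-cost<gain = ≤-<-trans (+-mono-≤ (sum-cost true) (sum-cost false))
                                 (*-cancelˡ-< (2 ^ D) _ _ scaled-cost<gain)

      cheap : Σ Bool λ b → Σ (List (Fin N)) λ T → cost b T < gain b T
      cheap with σTuples N D [] (cost true) <? σTuples N D [] (gain true)
      ... | yes p = true , σTuples-< N D [] (cost true) (gain true) p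
      ... | no p = false , σTuples-< N D [] (cost false) (gain false)
                     (+-cancelˡ-< (σTuples N D [] (gain true)) _ _ (≤-<-trans (+-monoˡ-≤ _ (≮⇒≥ p)) total-cost<gain))

      -- cost < gain forces X > m; if T were Δ-bad, bad-extensions would give
      -- X^Δ ≤ (2Δ)^Δ badExt < (2Δ)^e q X = m^e X ≤ X^Δ.
      cheap-good : ∀ b T → cost b T < gain b T → (m < X b T) × (bad b T D [] ≡ false)
      cheap-good b T lt = m<X , notBad
        where
        Y = badExt b T D []
        m<X : m < X b T
        m<X = *-cancelˡ-< q m (X b T) (≤-<-trans (m≤n+m (q * m) (2 * D * Y)) lt)
        2DY<qX : 2 * D * Y < q * X b T
        2DY<qX = ≤-<-trans (m≤m+n (2 * D * Y) (q * m)) lt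
        [2D]ᵉq≡mᵉ : (2 * D) ^ e * q ≡ m ^ e
        [2D]ᵉq≡mᵉ = begin
          (2 * D) ^ e * (2 ^ e * n ^ e) ≡⟨ sym (*-assoc ((2 * D) ^ e) (2 ^ e) (n ^ e)) ⟩
          (2 * D) ^ e * 2 ^ e * n ^ e   ≡⟨ cong (_* n ^ e) (sym (*-^-distrib (2 * D) 2 e)) ⟩
          (2 * D * 2) ^ e * n ^ e       ≡⟨ sym (*-^-distrib (2 * D * 2) n e) ⟩
          (2 * D * 2 * n) ^ e           ≡⟨ cong (λ z → (z * n) ^ e) (solve 1 (λ D → con 2 :* D :* con 2 := con 4 :* D) refl D) ⟩
          m ^ e                         ∎
          where open ≡-Reasoning
        fewBadExt : (2 * D) ^ D * Y < X b T ^ D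
        fewBadExt = begin-strict
          (2 * D) ^ D * Y           ≡⟨ *-assoc (2 * D) ((2 * D) ^ e) Y ⟩
          2 * D * ((2 * D) ^ e * Y) ≡⟨ solve 3 (λ a E Y → a :* (E :* Y) := E :* (a :* Y)) refl (2 * D) ((2 * D) ^ e) Y ⟩
          (2 * D) ^ e * (2 * D * Y) <⟨ *-monoʳ-< ((2 * D) ^ e) {{>-nonZero (m^n>0 (2 * D) e)}} 2DY<qX ⟩
          (2 * D) ^ e * (q * X b T) ≡⟨ sym (*-assoc ((2 * D) ^ e) q (X b T)) ⟩
          (2 * D) ^ e * q * X b T   ≡⟨ cong (_* X b T) [2D]ᵉq≡mᵉ ⟩
          m ^ e * X b T             ≤⟨ *-monoˡ-≤ (X b T) (^-monoˡ-≤ e (<⇒≤ m<X)) ⟩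
          X b T ^ e * X b T         ≡⟨ *-comm (X b T ^ e) (X b T) ⟩
          X b T ^ D                 ∎
          where open ≤-Reasoning
        notBad : bad b T D [] ≡ false
        notBad with bad b T D [] in isBad
        ... | false = refl
        ... | true = ⊥-elim (<⇒≱ fewBadExt (Bad.bad-extensions b T n D D [] refl isBad))

      select : Σ Bool λ b → Σ (List (Fin N)) λ T → (m < X b T) × (bad b T D [] ≡ false)
      select with cheap
      ... | b , T , lt = b , T , cheap-good b T lt

module GreedyEmbedding where

  open import Data.Nat
  open import Data.Nat.Properties
  open import Data.Bool using (Bool; true; false; if_then_else_; _∧_; not)
  open import Data.Bool.Properties using (∧-zeroʳ) renaming (_≟_ to _≟ᵇ_)
  open import Data.Fin using (Fin)
  open import Data.List using (List; []; _∷_; allFin)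
  open import Data.List.Relation.Unary.Any using (here; there)
  open import Data.List.Membership.Propositional using (_∈_)
  open import Data.List.Membership.Propositional.Properties using (∈-allFin)
  open import Data.Product using (Σ; _×_; _,_; proj₁)
  open import Data.Empty using (⊥-elim)
  open import Relation.Binary.PropositionalEquality
  open import Relation.Nullary using (¬_; yes; no)
  open import Function.Definitions using (Injective)
  open import Defs using (SimpleGraph; Adj; degree)
  open Counting
  open DependentRandomChoice

  module Embedding (N : ℕ) (c : Fin N → Fin N → Bool) (csym : ∀ i j → c i j ≡ c j i) where
    open Colouring N c csym

    -- Embed a bipartite H of maximum degree ≤ D, with sides side⁻¹ false (the
    -- "left" side, embedded first and inside U) and side⁻¹ true (the "right"
    -- side), given a D-tuple T whose common b-neighbourhood U has more than 2n
    -- vertices and which is not D-bad.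
    module Embed (b : Bool) (T : List (Fin N)) (n D : ℕ) (D>0 : 0 < D)
                 (H : SimpleGraph (Fin n)) (side : Fin n → Bool)
                 (bip : ∀ u v → Adj H u v ≡ true → ¬ (side u ≡ side v))
                 (degH : ∀ i → degree H i ≤ D)
                 (Xbig : 2 * n < Bad.X b T n D) (T-good : Bad.bad b T n D D [] ≡ false) where
      open Bad b T n D

      adj : Fin n → Fin n → Bool
      adj = Adj H

      in-degree : ∀ a → cnt n (λ w → adj w a) ≤ D
      in-degree a = begin
        cnt n (λ w → adj w a)        ≡⟨ σ-cong n (λ w → cong ⌜_⌝ (SimpleGraph.sym H w a)) ⟩
        σ n (λ w → ⌜ adj a w ⌝)      ≡⟨ sym (cntL-tabulate n (adj a) (λ i → i)) ⟩
        cntL (adj a) (allFin n)      ≤⟨ degH a ⟩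
        D                            ∎
        where open ≤-Reasoning

      right-of : ∀ {w a} → adj w a ≡ true → side a ≡ false → side w ≡ true
      right-of {w} {a} e sa with side w in sw
      ... | true = refl
      ... | false = ⊥-elim (bip w a e (trans sw (sym sa)))

      left-of : ∀ {w a} → adj w a ≡ true → side w ≡ true → side a ≡ false
      left-of {w} {a} e sw with side a in sa
      ... | false = refl
      ... | true = ⊥-elim (bip w a e (trans sw (sym sa)))

      different : ∀ {u v} → side u ≡ true → side v ≡ false → (u == v) ≡ false
      different {u} {v} su sv with u == v in e
      ... | false = refl
      ... | true = ⊥-elim (true≢false (trans (sym su) (trans (cong side (==-sound u v e)) sv)))

      different′ : ∀ {u v} → side u ≡ false → side v ≡ true → (u == v) ≡ false
      different′ {u} {v} su sv = trans (==-sym u v) (different sv su)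

      -- A partial embedding: the embedded vertices, their images, and for
      -- each right vertex w the images L w of its embedded neighbours together
      -- with a budget r w for its neighbours still to come.
      record State : Set where
        field
          done : Fin n → Bool
          g    : Fin n → Fin N
          L    : Fin n → List (Fin N)
          r    : Fin n → ℕ
      open State

      _⊑_ : State → State → Set
      s ⊑ s' = ∀ u → done s u ≡ true → done s' u ≡ true

      Injective-on-done : State → Set
      Injective-on-done s = ∀ a a' → done s a ≡ true → done s a' ≡ true → g s a ≡ g s a' → a ≡ a'

      Unused : State → Fin N → Set
      Unused s y = ∀ u → done s u ≡ true → ¬ (g s u ≡ y)

      place : State → Fin n → Fin N → State
      place s a y = record s
        { done = λ u → if u == a then true else done s u
        ; g    = λ u → if u == a then y else g s u }

      place-⊑ : ∀ s a y → s ⊑ place s a y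
      place-⊑ s a y u d with u == a
      ... | true = refl
      ... | false = d

      place-done : ∀ s a y → done (place s a y) a ≡ true
      place-done s a y rewrite ==-refl a = refl

      place-done-other : ∀ s a y {u} → (u == a) ≡ false → done (place s a y) u ≡ done s u
      place-done-other s a y e rewrite e = refl

      place-g-other : ∀ s a y {u} → (u == a) ≡ false → g (place s a y) u ≡ g s u
      place-g-other s a y e rewrite e = refl

      place-injective : ∀ s a y → Injective-on-done s → Unused s y → Injective-on-done (place s a y)
      place-injective s a y inj unused a₁ a₂ d₁ d₂ same with a₁ == a in e₁ | a₂ == a in e₂
      ... | true  | true  = trans (==-sound a₁ a e₁) (sym (==-sound a₂ a e₂))
      ... | true  | false = ⊥-elim (unused a₂ d₂ (sym same))
      ... | false | true  = ⊥-elim (unused a₁ d₁ same)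
      ... | false | false = inj a₁ a₂ d₁ d₂ same

      fresh : ∀ s (P : Fin N → Bool) → n < cnt N P → Σ (Fin N) λ y → (P y ≡ true) × Unused s y
      fresh s P n<P with cnt-witness N P used fewUsed
        where
        used : Fin N → Bool
        used y = anyF n (λ u → done s u ∧ (g s u == y))
        fewUsed : cnt N (λ y → P y ∧ used y) < cnt N P
        fewUsed = ≤-<-trans (≤-trans (cnt-mono N (λ y → ∧-elimʳ))
                            (≤-trans (cnt-image N n (done s) (g s)) (cnt≤ n (done s)))) n<P
      ... | y , Py , notUsed = y , Py , unused
        where
        unused : Unused s y
        unused u du gu≡y with anyF-false n _ notUsed u
        ... | e rewrite du | gu≡y | ==-refl y = true≢false e

      Swept : Bool → (List (Fin n) → State → Set) → List (Fin n) → State → Set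
      Swept β Inv vs s = Σ State λ s' → Inv [] s' × s ⊑ s' × (∀ u → u ∈ vs → side u ≡ β → done s' u ≡ true)

      swept-cons : ∀ {β Inv} a vs s s₁ → s ⊑ s₁ → (side a ≡ β → done s₁ a ≡ true) →
        Swept β Inv vs s₁ → Swept β Inv (a ∷ vs) s
      swept-cons a vs s s₁ s⊑s₁ doneA (s' , inv' , s₁⊑s' , cover) =
        s' , inv' , (λ u d → s₁⊑s' u (s⊑s₁ u d)) , cover'
        where
        cover' : ∀ u → u ∈ a ∷ vs → _ → done s' u ≡ true
        cover' u (here refl) su = s₁⊑s' u (doneA su)
        cover' u (there u∈vs) su = cover u u∈vs su

      sweep : (β : Bool) (Inv : List (Fin n) → State → Set) →
        (skip : ∀ a vs s → Inv (a ∷ vs) s → Inv vs s) →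
        (step : ∀ a vs s → Inv (a ∷ vs) s → side a ≡ β → done s a ≡ false →
                  Σ State λ s' → Inv vs s' × s ⊑ s' × done s' a ≡ true) →
        ∀ vs s → Inv vs s → Swept β Inv vs s
      sweep β Inv skip step [] s inv = s , inv , (λ u d → d) , (λ u ())
      sweep β Inv skip step (a ∷ vs) s inv with side a ≟ᵇ β
      ... | no a∉β =
        swept-cons {β} {Inv} a vs s s (λ u d → d) (λ a∈β → ⊥-elim (a∉β a∈β)) (sweep β Inv skip step vs s (skip a vs s inv))
      ... | yes a∈β with done s a in da
      ...   | true =
        swept-cons {β} {Inv} a vs s s (λ u d → d) (λ _ → da) (sweep β Inv skip step vs s (skip a vs s inv))
      ...   | false with step a vs s inv a∈β da
      ...     | s₁ , inv₁ , s⊑s₁ , doneA =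
        swept-cons {β} {Inv} a vs s s₁ s⊑s₁ (λ _ → doneA) (sweep β Inv skip step vs s₁ inv₁)

      -- Phase 1 embeds the left side into U.  vs lists the vertices still to be
      -- processed; a right vertex w keeps the images of its embedded
      -- neighbours in L w, which is not (r w)-bad, where r w bounds the number
      -- of its neighbours still to be embedded.
      record Phase1 (vs : List (Fin n)) (s : State) : Set where
        field
          budget    : ∀ w → side w ≡ true → cntL (λ u → adj w u ∧ not (done s u)) vs ≤ r s w
          notBad    : ∀ w → side w ≡ true → bad (r s w) (L s w) ≡ false
          recorded  : ∀ w → side w ≡ true → ∀ a y → done s a ≡ true → adj w a ≡ true →
                        joined b y (L s w) ≡ true → c y (g s a) ≡ b
          injective : Injective-on-done s
          rightFree : ∀ w → side w ≡ true → done s w ≡ false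
      open Phase1

      phase1-skip : ∀ a vs s → Phase1 (a ∷ vs) s → Phase1 vs s
      phase1-skip a vs s inv = record
        { budget = λ w sw → m+n≤o⇒n≤o _ (budget inv w sw)
        ; notBad = notBad inv ; recorded = recorded inv ; injective = injective inv ; rightFree = rightFree inv }

      embedLeft : State → Fin n → Fin N → State
      embedLeft s a y = record (place s a y)
        { L = λ w → if adj w a then y ∷ L s w else L s w
        ; r = λ w → if adj w a then pred (r s w) else r s w }

      embedLeft-preserves : ∀ a vs s y → Phase1 (a ∷ vs) s → side a ≡ false → done s a ≡ false →
        (∀ w → adj w a ≡ true → bad (pred (r s w)) (y ∷ L s w) ≡ false) → Unused s y →
        Phase1 vs (embedLeft s a y)
      embedLeft-preserves a vs s y inv sa da yGood unused = record
        { budget = budget′ ; notBad = notBad′ ; recorded = recorded′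
        ; injective = place-injective s a y (injective inv) unused
        ; rightFree = λ w sw → trans (place-done-other s a y (different sw sa)) (rightFree inv w sw) }
        where
        s′ = embedLeft s a y
        still-open : ∀ x {d d′} → (d ≡ true → d′ ≡ true) → x ∧ not d′ ≡ true → x ∧ not d ≡ true
        still-open x {true} d⇒d′ e rewrite d⇒d′ refl | ∧-zeroʳ x = e
        still-open true {false} d⇒d′ e = refl
        budget′ : ∀ w → side w ≡ true → cntL (λ u → adj w u ∧ not (done s′ u)) vs ≤ r s′ w
        budget′ w sw = ≤-trans (cntL-mono (λ u → still-open (adj w u) (place-⊑ s a y u)) vs)
                               (spend (budget inv w sw))
          where
          C = cntL (λ u → adj w u ∧ not (done s u)) vs
          spend : ⌜ adj w a ∧ not (done s a) ⌝ + C ≤ r s w → C ≤ r s′ w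
          spend h with adj w a
          ... | true rewrite da = pred-mono-≤ h
          ... | false = h
        notBad′ : ∀ w → side w ≡ true → bad (r s′ w) (L s′ w) ≡ false
        notBad′ w sw with adj w a in aw
        ... | true = yGood w aw
        ... | false = notBad inv w sw
        recorded′ : ∀ w → side w ≡ true → ∀ a′ y′ → done s′ a′ ≡ true → adj w a′ ≡ true →
                      joined b y′ (L s′ w) ≡ true → c y′ (g s′ a′) ≡ b
        recorded′ w sw a′ y′ d′ aw′ j with a′ == a in e
        ... | true with ==-sound a′ a e
        ...   | refl = coloured-sound b (∧-elimˡ (subst (λ t → joined b y′ (if t then y ∷ L s w else L s w) ≡ true) aw′ j))
        recorded′ w sw a′ y′ d′ aw′ j | false =
          recorded inv w sw a′ y′ d′ aw′ (old-list (adj w a) j)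
          where
          old-list : ∀ t → joined b y′ (if t then y ∷ L s w else L s w) ≡ true → joined b y′ (L s w) ≡ true
          old-list true = ∧-elimʳ
          old-list false j = j

      module LeftStep (a : Fin n) (vs : List (Fin n)) (s : State) (inv : Phase1 (a ∷ vs) s)
                      (sa : side a ≡ false) (da : done s a ≡ false) where

        badFor : Fin N → Fin n → Bool
        badFor x w = adj w a ∧ bad (pred (r s w)) (x ∷ L s w)

        candidate : Fin N → Bool
        candidate x = U x ∧ not (anyF n (badFor x))

        -- Every neighbour w of a still has a to embed, so a positive budget.
        budget-pos : ∀ w → adj w a ≡ true → 1 ≤ r s w
        budget-pos w aw = m+n≤o⇒m≤o 1
          (subst (λ t → t + _ ≤ r s w) (cong₂ (λ p q → ⌜ p ∧ not q ⌝) aw da) (budget inv w (right-of aw sa)))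

        -- Each neighbour rules out fewer than X / 2D vertices of U, as L w is not bad.
        per-neighbour : ∀ w → 2 * D * cnt N (λ x → U x ∧ badFor x w) ≤ ⌜ adj w a ⌝ * X
        per-neighbour w with adj w a in aw
        ... | false = ≤-reflexive (trans (cong (2 * D *_) (σ-zero N _ (λ x → cong ⌜_⌝ (∧-zeroʳ (U x))))) (*-zeroʳ (2 * D)))
        ... | true = ≤-trans (<⇒≤ (not-bad-pred (r s w) (L s w) (budget-pos w aw) (notBad inv w (right-of aw sa))))
                             (≤-reflexive (sym (+-identityʳ X)))

        -- Since a has at most D neighbours, at most half of U is ruled out.
        few-ruled-out : 2 * cnt N (λ x → U x ∧ anyF n (badFor x)) ≤ X
        few-ruled-out = ≤-trans (*-monoʳ-≤ 2 (cnt-anyF N n U (λ w x → badFor x w)))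
          (*-cancelˡ-≤ D {{>-nonZero D>0}} (begin
            D * (2 * S)                                       ≡⟨ sym (*-assoc D 2 S) ⟩
            D * 2 * S                                         ≡⟨ cong (_* S) (*-comm D 2) ⟩
            2 * D * S                                         ≡⟨ sym (σ-*ˡ n (2 * D) _) ⟩
            σ n (λ w → 2 * D * cnt N (λ x → U x ∧ badFor x w)) ≤⟨ σ-mono n per-neighbour ⟩
            σ n (λ w → ⌜ adj w a ⌝ * X)                       ≡⟨ trans (σ-cong n (λ w → *-comm ⌜ adj w a ⌝ X)) (σ-*ˡ n X _) ⟩
            X * cnt n (λ w → adj w a)                         ≤⟨ *-monoʳ-≤ X (in-degree a) ⟩
            X * D                                             ≡⟨ *-comm X D ⟩
            D * X                                             ∎))
          where
          open ≤-Reasoning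
          S = σ n (λ w → cnt N (λ x → U x ∧ badFor x w))

        -- Hence more than X / 2 > n candidates remain.
        many-candidates : n < cnt N candidate
        many-candidates = *-cancelˡ-< 2 n G (<-≤-trans Xbig (+-cancelˡ-≤ X X (2 * G) (begin
          X + X         ≡⟨ cong (X +_) (sym (+-identityʳ X)) ⟩
          2 * X         ≡⟨ cong (2 *_) (cnt-split N U (λ x → anyF n (badFor x))) ⟩
          2 * (G + B)   ≡⟨ *-distribˡ-+ 2 G B ⟩
          2 * G + 2 * B ≤⟨ +-monoʳ-≤ (2 * G) few-ruled-out ⟩
          2 * G + X     ≡⟨ +-comm (2 * G) X ⟩
          X + 2 * G     ∎)))
          where
          open ≤-Reasoning
          G = cnt N candidate
          B = cnt N (λ x → U x ∧ anyF n (badFor x))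

        step : Σ State λ s′ → Phase1 vs s′ × s ⊑ s′ × done s′ a ≡ true
        step with fresh s candidate many-candidates
        ... | y , cand , unused = embedLeft s a y
                                , embedLeft-preserves a vs s y inv sa da yGood unused
                                , place-⊑ s a y , place-done s a y
          where
          yGood : ∀ w → adj w a ≡ true → bad (pred (r s w)) (y ∷ L s w) ≡ false
          yGood w aw = subst (λ t → t ∧ bad (pred (r s w)) (y ∷ L s w) ≡ false) aw
                             (anyF-false n (badFor y) (not-true (∧-elimʳ cand)) w)

      -- Phase 2 embeds the right side: w goes to an unused vertex joined in
      -- colour b to all of L w, i.e. to the images of all its neighbours.
      record Phase2 (s : State) : Set where
        field
          leftDone  : ∀ a → side a ≡ false → done s a ≡ true
          notBad    : ∀ w → side w ≡ true → bad (r s w) (L s w) ≡ false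
          recorded  : ∀ w → side w ≡ true → ∀ a y → done s a ≡ true → adj w a ≡ true →
                        joined b y (L s w) ≡ true → c y (g s a) ≡ b
          injective : Injective-on-done s
          edges     : ∀ w → side w ≡ true → done s w ≡ true → ∀ a → adj w a ≡ true → c (g s w) (g s a) ≡ b
      open Phase2

      -- As L w is not bad it has more than n common neighbours, so one is unused.
      embedRight-step : ∀ w (vs : List (Fin n)) s → Phase2 s → side w ≡ true → done s w ≡ false →
        Σ State λ s′ → Phase2 s′ × s ⊑ s′ × done s′ w ≡ true
      embedRight-step w _ s inv sw _
        with fresh s (λ y → joined b y (L s w)) (not-bad-large D>0 (r s w) (L s w) (notBad inv w sw))
      ... | y , joinedY , unused = s′ , inv′ , place-⊑ s w y , place-done s w y
        where
        s′ = place s w y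
        left≠w : ∀ {a} → side a ≡ false → (a == w) ≡ false
        left≠w sa = different′ sa sw
        inv′ : Phase2 s′
        inv′ = record
          { leftDone = λ a sa → place-⊑ s w y a (leftDone inv a sa)
          ; notBad = notBad inv
          ; recorded = λ w′ sw′ a y′ d′ aw j →
              let sa = left-of aw sw′ in
              subst (λ z → c y′ z ≡ b) (sym (place-g-other s w y (left≠w sa)))
                (recorded inv w′ sw′ a y′ (trans (sym (place-done-other s w y (left≠w sa))) d′) aw j)
          ; injective = place-injective s w y (injective inv) unused
          ; edges = edges′ }
          where
          edges′ : ∀ w′ → side w′ ≡ true → done s′ w′ ≡ true → ∀ a → adj w′ a ≡ true → c (g s′ w′) (g s′ a) ≡ b
          edges′ w′ sw′ d′ a aw with w′ == w in e
          ... | true = trans (cong (c y) (place-g-other s w y (left≠w sa)))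
                             (recorded inv w sw a y (leftDone inv a sa) aw′ joinedY)
            where
            sa = left-of aw sw′
            aw′ : adj w a ≡ true
            aw′ = subst (λ z → adj z a ≡ true) (==-sound w′ w e) aw
          ... | false = trans (cong (c (g s w′)) (place-g-other s w y (left≠w (left-of aw sw′))))
                              (edges inv w′ sw′ d′ a aw)

      -- U is nonempty, which provides a default image.
      x₀ : Fin N
      x₀ = proj₁ (cnt-pos N U (≤-<-trans z≤n Xbig))
      s₀ : State
      s₀ = record { done = λ _ → false ; g = λ _ → x₀ ; L = λ _ → [] ; r = λ _ → D }
      start : Phase1 (allFin n) s₀
      start = record
        { budget = λ w _ → ≤-trans (cntL-mono (λ u → ∧-elimˡ) (allFin n)) (degH w)
        ; notBad = λ _ _ → T-good
        ; recorded = λ { _ _ _ _ () }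
        ; injective = λ { _ _ () }
        ; rightFree = λ _ _ → refl }
      switch : ∀ s → Phase1 [] s → (∀ u → u ∈ allFin n → side u ≡ false → done s u ≡ true) → Phase2 s
      switch s inv covered = record
        { leftDone = λ a sa → covered a (∈-allFin a) sa
        ; notBad = notBad inv ; recorded = recorded inv ; injective = injective inv
        ; edges = λ w sw d → ⊥-elim (true≢false (trans (sym d) (rightFree inv w sw))) }

      embedding : Σ (Fin n → Fin N) λ f → Injective _≡_ _≡_ f × (∀ u v → adj u v ≡ true → c (f u) (f v) ≡ b)
      embedding with sweep false Phase1 phase1-skip LeftStep.step (allFin n) s₀ start
      ... | s₁ , inv₁ , _ , leftCovered
        with sweep true (λ _ → Phase2) (λ _ _ _ inv → inv) embedRight-step (allFin n) s₁ (switch s₁ inv₁ leftCovered)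
      ... | s₂ , inv₂ , _ , rightCovered =
        g s₂ , (λ {u} {v} → injective inv₂ u v (allDone u) (allDone v)) , monochromatic
        where
        allDone : ∀ u → done s₂ u ≡ true
        allDone u with side u in su
        ... | true = rightCovered u (∈-allFin u) su
        ... | false = leftDone inv₂ u su
        monochromatic : ∀ u v → adj u v ≡ true → c (g s₂ u) (g s₂ v) ≡ b
        monochromatic u v e with side u in su
        ... | true = edges inv₂ u su (allDone u) v e
        ... | false = trans (csym (g s₂ u) (g s₂ v))
                            (edges inv₂ v (right-of (trans (SimpleGraph.sym H v u) e) su) (allDone v) u
                                   (trans (SimpleGraph.sym H v u) e))

module Cube where

  open import Data.Nat hiding (parity)
  open import Data.Nat.Properties
  open import Data.Bool using (Bool; true; false; not; _xor_; if_then_else_)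
  open import Data.Bool.Properties using (xor-∧-commutativeRing; xor-same)
  open import Data.Fin using (Fin; zero; splitAt; _↑ˡ_; _↑ʳ_) renaming (suc to fsuc)
  open import Data.Fin.Properties using (splitAt-↑ˡ; splitAt-↑ʳ)
  open import Data.Vec using (Vec; []; _∷_)
  open import Data.Sum using ([_,_]′)
  open import Relation.Binary.PropositionalEquality
  open import Relation.Nullary using (¬_)
  open import Algebra.Bundles using (CommutativeRing)
  open import Algebra.Properties.CommutativeSemigroup
    (CommutativeRing.+-commutativeSemigroup xor-∧-commutativeRing) using (interchange)
  open import Defs using (Adj; Q; hamming)
  open Counting

  -- Vertices of Q_d are enumerated by Fin (size d), size d = 2 ^ d, through
  -- decode; the first half of Fin (size (d+1)) starts with false.
  size : ℕ → ℕ
  size zero = 1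
  size (suc d) = size d + size d

  size≡2^ : ∀ d → size d ≡ 2 ^ d
  size≡2^ zero = refl
  size≡2^ (suc d) rewrite size≡2^ d = cong (2 ^ d +_) (sym (+-identityʳ (2 ^ d)))

  decode : ∀ d → Fin (size d) → Vec Bool d
  decode zero _ = []
  decode (suc d) i = [ (λ j → false ∷ decode d j) , (λ j → true ∷ decode d j) ]′ (splitAt (size d) i)

  encode : ∀ d → Vec Bool d → Fin (size d)
  encode zero [] = zero
  encode (suc d) (false ∷ v) = encode d v ↑ˡ size d
  encode (suc d) (true ∷ v) = size d ↑ʳ encode d v

  decode-left : ∀ d i → decode (suc d) (i ↑ˡ size d) ≡ false ∷ decode d i
  decode-left d i rewrite splitAt-↑ˡ (size d) i (size d) = refl

  decode-right : ∀ d i → decode (suc d) (size d ↑ʳ i) ≡ true ∷ decode d i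
  decode-right d i rewrite splitAt-↑ʳ (size d) (size d) i = refl

  decode-encode : ∀ d v → decode d (encode d v) ≡ v
  decode-encode zero [] = refl
  decode-encode (suc d) (false ∷ v) = trans (decode-left d (encode d v)) (cong (false ∷_) (decode-encode d v))
  decode-encode (suc d) (true ∷ v) = trans (decode-right d (encode d v)) (cong (true ∷_) (decode-encode d v))

  σVec : (d : ℕ) → (Vec Bool d → ℕ) → ℕ
  σVec zero h = h []
  σVec (suc d) h = σVec d (λ v → h (false ∷ v)) + σVec d (λ v → h (true ∷ v))

  σVec-cong : ∀ d {f g : Vec Bool d → ℕ} → (∀ v → f v ≡ g v) → σVec d f ≡ σVec d g
  σVec-cong zero e = e []
  σVec-cong (suc d) e = cong₂ _+_ (σVec-cong d (λ v → e (false ∷ v))) (σVec-cong d (λ v → e (true ∷ v)))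

  σVec-zero : ∀ d → σVec d (λ _ → 0) ≡ 0
  σVec-zero zero = refl
  σVec-zero (suc d) rewrite σVec-zero d = refl

  σ-+-split : ∀ m k (h : Fin (m + k) → ℕ) → σ (m + k) h ≡ σ m (λ i → h (i ↑ˡ k)) + σ k (λ j → h (m ↑ʳ j))
  σ-+-split zero k h = refl
  σ-+-split (suc m) k h = trans (cong (h zero +_) (σ-+-split m k (λ i → h (fsuc i)))) (sym (+-assoc (h zero) _ _))

  σ-decode : ∀ d (h : Vec Bool d → ℕ) → σ (size d) (λ i → h (decode d i)) ≡ σVec d h
  σ-decode zero h = +-identityʳ (h [])
  σ-decode (suc d) h = trans (σ-+-split (size d) (size d) (λ i → h (decode (suc d) i)))
    (cong₂ _+_ (trans (σ-cong (size d) (λ i → cong h (decode-left d i)))  (σ-decode d (λ v → h (false ∷ v))))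
               (trans (σ-cong (size d) (λ i → cong h (decode-right d i))) (σ-decode d (λ v → h (true ∷ v)))))

  isZero isOne : ℕ → Bool
  isZero zero = true
  isZero (suc _) = false
  isOne zero = false
  isOne (suc k) = isZero k

  Adj-Q : ∀ d (x y : Vec Bool d) → Adj (Q d) x y ≡ isOne (hamming x y)
  Adj-Q d x y with hamming x y
  ... | zero = refl
  ... | suc zero = refl
  ... | suc (suc k) = refl

  -- Each x has at most one vertex at distance 0 and at most d at distance 1:
  -- splitting on the first coordinate, the distance-1 vertices of a ∷ x are
  -- those of x behind a and the distance-0 vertex of x behind not a.
  at-distance-0 : ∀ d x → σVec d (λ y → ⌜ isZero (hamming x y) ⌝) ≤ 1
  at-distance-1 : ∀ d x → σVec d (λ y → ⌜ isOne (hamming x y) ⌝) ≤ d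
  at-distance-0 zero [] = ≤-refl
  at-distance-0 (suc d) (false ∷ x) rewrite σVec-zero d | +-identityʳ (σVec d (λ y → ⌜ isZero (hamming x y) ⌝)) = at-distance-0 d x
  at-distance-0 (suc d) (true ∷ x) rewrite σVec-zero d = at-distance-0 d x
  at-distance-1 zero [] = z≤n
  at-distance-1 (suc d) (false ∷ x) = ≤-trans (+-mono-≤ (at-distance-1 d x) (at-distance-0 d x)) (≤-reflexive (+-comm d 1))
  at-distance-1 (suc d) (true ∷ x) = +-mono-≤ (at-distance-0 d x) (at-distance-1 d x)

  parity : ∀ {d} → Vec Bool d → Bool
  parity [] = false
  parity (a ∷ v) = a xor parity v

  odd : ℕ → Bool
  odd zero = false
  odd (suc k) = not (odd k)

  odd-hamming : ∀ {d} (x y : Vec Bool d) → odd (hamming x y) ≡ parity x xor parity y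
  odd-hamming [] [] = refl
  odd-hamming (a ∷ x) (b ∷ y) = trans (first (a xor b) (hamming x y))
    (trans (cong ((a xor b) xor_) (odd-hamming x y)) (interchange a b (parity x) (parity y)))
    where
    first : ∀ t h → odd ((if t then 1 else 0) + h) ≡ t xor odd h
    first true h = refl
    first false h = refl

  Q-bipartite : ∀ d (x y : Vec Bool d) → Adj (Q d) x y ≡ true → ¬ (parity x ≡ parity y)
  Q-bipartite d x y e same = true≢false (begin
    true                      ≡⟨ cong odd (sym (distance-one (hamming x y) (trans (sym (Adj-Q d x y)) e))) ⟩
    odd (hamming x y)         ≡⟨ odd-hamming x y ⟩
    parity x xor parity y     ≡⟨ cong (_xor parity y) same ⟩
    parity y xor parity y     ≡⟨ xor-same (parity y) ⟩
    false                     ∎)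
    where
    open ≡-Reasoning
    distance-one : ∀ k → isOne k ≡ true → k ≡ 1
    distance-one (suc zero) _ = refl

open import Defs
open import Data.Nat using (ℕ; _*_; _+_; _^_; _≤_)
open import Data.Fin using (Fin)
open import Data.Product using (_×_)

open import Data.Nat using (zero; suc; z≤n; s≤s; z<s)
open import Data.Nat.Properties using (≤-refl; ≤-reflexive; ≤-trans; ≤-<-trans; *-monoˡ-≤; m≤m*n; *-assoc; ^-distribˡ-+-*; module ≤-Reasoning)
open import Data.Nat.Solver using (module +-*-Solver)
open import Data.Bool using (true)
open import Data.Product using (_,_)
open import Function.Definitions using (Injective)
open import Relation.Binary.PropositionalEquality hiding (sym)
open import Relation.Binary.PropositionalEquality using () renaming (sym to ≡-sym)
open DependentRandomChoice using (module Colouring)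
open GreedyEmbedding using (module Embedding)
open Counting using (⌜_⌝; σ; cntL-tabulate)
open Cube

ramsey-bound : ℕ → ℕ → ℕ
ramsey-bound Δ n = Δ * 2 ^ (Δ + 3) * n

bipartite-arrows : ∀ n (H : SimpleGraph (Fin n)) e → Bipartite H → (∀ i → degree H i ≤ suc e) →
  Arrows (ramsey-bound (suc e) n) H
bipartite-arrows zero H e _ _ c csym = true , (λ ()) , (λ { {()} }) , (λ ())
bipartite-arrows n@(suc _) H e (side , bip) deg c csym
  with Colouring.Selection.select (ramsey-bound (suc e) n) c csym n e z<s refl
... | b , T , 4Δn<X , T-good =
  b , Embedding.Embed.embedding (ramsey-bound (suc e) n) c csym b T n (suc e) z<s H side bip deg
        (≤-<-trans (*-monoˡ-≤ n 2≤4Δ) 4Δn<X) T-good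
  where
  2≤4Δ : 2 ≤ 4 * suc e
  2≤4Δ = ≤-trans (s≤s (s≤s z≤n)) (m≤m*n 4 (suc e))

arrows-subgraph : ∀ {V W} {G : SimpleGraph V} {G′ : SimpleGraph W} {N} (e : V → W) → Injective _≡_ _≡_ e →
  (∀ u v → Adj G u v ≡ true → Adj G′ (e u) (e v) ≡ true) → Arrows N G′ → Arrows N G
arrows-subgraph e e-inj e-adj arrows c csym with arrows c csym
... | b , f , f-inj , f-mono =
  b , (λ v → f (e v)) , (λ same → e-inj (f-inj same)) , (λ u v uv → f-mono (e u) (e v) (e-adj u v uv))

Q-enum : (d : ℕ) → SimpleGraph (Fin (size d))
Q-enum d = record
  { Adj = λ i j → Adj (Q d) (decode d i) (decode d j)
  ; sym = λ i j → SimpleGraph.sym (Q d) (decode d i) (decode d j)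
  ; irrefl = λ i → SimpleGraph.irrefl (Q d) (decode d i) }

Q-enum-bipartite : ∀ d → Bipartite (Q-enum d)
Q-enum-bipartite d = (λ i → parity (decode d i)) , (λ u v → Q-bipartite d (decode d u) (decode d v))

Q-enum-degree : ∀ d i → degree (Q-enum d) i ≤ d
Q-enum-degree d i = begin
  degree (Q-enum d) i                       ≡⟨ cntL-tabulate (size d) (λ j → Adj (Q d) x (decode d j)) (λ j → j) ⟩
  σ (size d) (λ j → ⌜ Adj (Q d) x (decode d j) ⌝) ≡⟨ σ-decode d (λ y → ⌜ Adj (Q d) x y ⌝) ⟩
  σVec d (λ y → ⌜ Adj (Q d) x y ⌝)          ≡⟨ σVec-cong d (λ y → cong ⌜_⌝ (Adj-Q d x y)) ⟩
  σVec d (λ y → ⌜ isOne (hamming x y) ⌝)    ≤⟨ at-distance-1 d x ⟩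
  d                                         ∎
  where
  open ≤-Reasoning
  x = decode d i

Q-arrows : ∀ d N → Arrows N (Q-enum d) → Arrows N (Q d)
Q-arrows d N = arrows-subgraph {G = Q d} {G′ = Q-enum d} {N} (encode d)
  (λ {x} {y} same → trans (≡-sym (decode-encode d x)) (trans (cong (decode d) same) (decode-encode d y)))
  (λ u v uv → subst (_≡ true) (≡-sym (cong₂ (Adj (Q d)) (decode-encode d u) (decode-encode d v))) uv)

cube-bound : ∀ d → ramsey-bound d (size d) ≡ d * 2 ^ (2 * d + 3)
cube-bound d = begin
  d * 2 ^ (d + 3) * size d     ≡⟨ cong (d * 2 ^ (d + 3) *_) (size≡2^ d) ⟩
  d * 2 ^ (d + 3) * 2 ^ d      ≡⟨ *-assoc d (2 ^ (d + 3)) (2 ^ d) ⟩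
  d * (2 ^ (d + 3) * 2 ^ d)    ≡⟨ cong (d *_) (≡-sym (^-distribˡ-+-* 2 (d + 3) d)) ⟩
  d * 2 ^ (d + 3 + d)          ≡⟨ cong (λ t → d * 2 ^ t) (solve 1 (λ d → d :+ con 3 :+ d := con 2 :* d :+ con 3) refl d) ⟩
  d * 2 ^ (2 * d + 3)          ∎
  where
  open ≡-Reasoning
  open +-*-Solver

corollary6p2 : ((n : ℕ) (H : SimpleGraph (Fin n)) (Δ : ℕ) → 1 ≤ Δ → Bipartite H → MaxDegree H Δ →
      RamseyAtMost H (Δ * 2 ^ (Δ + 3) * n))
    ×
    ((d : ℕ) → 1 ≤ d → RamseyAtMost (Q d) (d * 2 ^ (2 * d + 3)))
corollary6p2 = bipartite , cube
  where
  bipartite : (n : ℕ) (H : SimpleGraph (Fin n)) (Δ : ℕ) → 1 ≤ Δ → Bipartite H → MaxDegree H Δ →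
    RamseyAtMost H (Δ * 2 ^ (Δ + 3) * n)
  bipartite n H (suc e) _ bip (deg≤Δ , _) = _ , ≤-refl , bipartite-arrows n H e bip deg≤Δ
  cube : (d : ℕ) → 1 ≤ d → RamseyAtMost (Q d) (d * 2 ^ (2 * d + 3))
  cube d@(suc e) _ = ramsey-bound d (size d) , ≤-reflexive (cube-bound d)
                   , Q-arrows d _ (bipartite-arrows (size d) (Q-enum d) e (Q-enum-bipartite d) (Q-enum-degree d))
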